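{- Let $n$ be a positive integer, $D_n=\langle x,a\mid x^n=a^2=e,\ ax=x^{ -1}a\rangle$, $C_n=\langle x\rangle$. Let $v$ be an odd positive divisor of $n$ and $l=n/v$. Let $T\subseteq\{x^1,\dots,x^{v-1}\}$ and $X=T\langle x^v\rangle=\bigcup_{x^b\in T}x^b\langle x^v\rangle$, and suppose $X\cap X^{(-1)}=\emptyset$ and $X\cup X^{(-1)}=C_n\setminus\langle x^v\rangle$. Then the Cayley graph $\mathcal{C}(D_n,X\cup Xa)$ is a directed strongly regular graph with parameters $$\left(2n,\;n-l,\;\frac{n-l}{2},\;\frac{n-l}{2}-l,\;\frac{n-l}{2}\right).$$
   Context: $Xa=\{ga:g\in X\}$, $X^{(-1)}=\{g^{ -1}:g\in X\}$. For $S\subseteq G\setminus\{e\}$, the Cayley graph $\mathcal{C}(G,S)$ has vertex set $G$ and an arc $u\to w$ iff $wu^{ -1}\in S$. A directed graph on $N$ vertices with $0/1$ adjacency matrix $A$ is a directed strongly regular graph with parameters $(N,k,\mu,\lambda,t)$ if $JA=AJ=kJ$ and $A^2=tI+\lambda A+\mu(J-I-A)$. -}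

module Defs where

open import Data.Nat using (ℕ; zero; suc; _+_; _*_; _∸_; _%_; NonZero)
open import Data.Nat.DivMod using (m%n<n)
open import Data.Fin using (Fin; toℕ; fromℕ<; remQuot)
open import Data.Fin.Properties using () renaming (_≟_ to _≟F_)
open import Data.Bool using (Bool; true; false; _∧_; _∨_; if_then_else_)
open import Data.Product using (_×_; _,_; proj₁; proj₂)
open import Data.Integer as ℤ using (ℤ; +_)
open import Relation.Nullary.Decidable using (⌊_⌋)
open import Relation.Binary.PropositionalEquality using (_≡_)

count : ∀ {N} → (Fin N → Bool) → ℕ
count {zero}  p = 0
count {suc N} p = (if p Data.Fin.zero then 1 else 0) + count (λ i → p (Data.Fin.suc i))

anyFin : ∀ {N} → (Fin N → Bool) → Bool
anyFin {zero}  p = false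
anyFin {suc N} p = p Data.Fin.zero ∨ anyFin (λ i → p (Data.Fin.suc i))

b2z : Bool → ℤ
b2z true  = + 1
b2z false = + 0

_==F_ : ∀ {N} → Fin N → Fin N → Bool
i ==F j = ⌊ i ≟F j ⌋

-- Directed strongly regular graph with parameters (N, k, μ, λ, t),
-- given by its 0/1 adjacency matrix A (entry A u w = true iff arc u → w).
-- A² = tI + λA + μ(J − I − A), stated entrywise over ℤ.

record IsDSRG (N : ℕ) (k μ λ' t : ℤ) (A : Fin N → Fin N → Bool) : Set where
  field
    JA≡kJ : ∀ w → + count (λ u → A u w) ≡ k
    AJ≡kJ : ∀ u → + count (λ w → A u w) ≡ k
    A²≡   : ∀ u w →
      + count (λ y → A u y ∧ A y w)
        ≡ (t ℤ.* b2z (u ==F w)) ℤ.+ (λ' ℤ.* b2z (A u w))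
          ℤ.+ (μ ℤ.* ((+ 1 ℤ.- b2z (u ==F w)) ℤ.- b2z (A u w)))

-- The dihedral group D_n = ⟨x, a | xⁿ = a² = e, a x = x⁻¹ a⟩.
-- An element (s , i) : Fin 2 × Fin n stands for x^i a^s.

D : ℕ → Set
D n = Fin 2 × Fin n

module Dihedral (n : ℕ) .{{_ : NonZero n}} where

  modn : ℕ → Fin n
  modn m = fromℕ< (m%n<n m n)

  isA : Fin 2 → Bool
  isA s = ⌊ s ≟F Data.Fin.suc Data.Fin.zero ⌋

  e : D n
  e = (Data.Fin.zero , modn 0)

  xpow : ℕ → D n
  xpow m = (Data.Fin.zero , modn m)

  a : D n
  a = (Data.Fin.suc Data.Fin.zero , modn 0)

  neg : Fin n → Fin n
  neg i = modn (n ∸ toℕ i)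

  xorF : Fin 2 → Fin 2 → Fin 2
  xorF s t = if isA s then (if isA t then Data.Fin.zero else Data.Fin.suc Data.Fin.zero) else t

  -- (x^i a^s)(x^j a^t) = x^(i ± j) a^(s+t), with sign − iff s = 1
  _·_ : D n → D n → D n
  (s , i) · (t , j) = (xorF s t , modn (toℕ i + toℕ (if isA s then neg j else j)))

  inv : D n → D n
  inv (s , i) = if isA s then (s , i) else (s , neg i)

  pow : D n → ℕ → D n
  pow g zero    = e
  pow g (suc m) = g · pow g m

  _==_ : D n → D n → Bool
  (s , i) == (t , j) = (s ==F t) ∧ (i ==F j)

  anyD : (D n → Bool) → Bool
  anyD p = anyFin (λ s → anyFin (λ i → p (s , i)))

  inCn : D n → Bool
  inCn g = anyFin (λ (j : Fin n) → g == pow (xpow 1) (toℕ j))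

  -- g ∈ ⟨h⟩ (powers h^0 … h^(2n-1) exhaust the cyclic subgroup)
  inCyc : D n → D n → Bool
  inCyc h g = anyFin (λ (j : Fin (n + n)) → g == pow h (toℕ j))

  -- X = T⟨x^v⟩ = ⋃_{x^b ∈ T} x^b ⟨x^v⟩, where T is given as a set of
  -- exponents b (T b = true iff x^b ∈ T).
  inX : (v : ℕ) → (Fin n → Bool) → D n → Bool
  inX v T g = anyFin (λ b → T b ∧ anyD (λ h → inCyc (xpow v) h ∧ (g == (xpow (toℕ b) · h))))

  inXuXa : (v : ℕ) → (Fin n → Bool) → D n → Bool
  inXuXa v T g = inX v T g ∨ anyD (λ h → inX v T h ∧ (g == (h · a)))

  cayley : (D n → Bool) → D n → D n → Bool
  cayley S u w = S (w · inv u)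

  vtx : Fin (2 * n) → D n
  vtx = remQuot n

  cayleyMat : (D n → Bool) → Fin (2 * n) → Fin (2 * n) → Bool
  cayleyMat S u w = cayley S (vtx u) (vtx w)

module Submission where

-- Let R ⊆ ℤᵥ be the set of exponents in T, so that xᵐ ∈ X iff m mod v ∈ R. The hypotheses on X say
-- that every residue lies in exactly one of R, −R and {0}. An arc xⁱaˢ → xʲaᵗ of the Cayley graph
-- is present iff j ± i mod v lies in R, so all in- and out-degrees equal 2|X|, which is n − l by
-- the trichotomy. The 2-walks from u to w through the two halves of Dₙ are counted by
-- #{m : m, d − m ∈ R} and #{m : m, m + d ∈ R} (m ranging over ℤₙ) for one and the same d, and the
-- trichotomy applied to d − m for each m ∈ R shows that these two numbers plus l·[d ∈ R] add up
-- to |X|. As t = μ = (n − l)/2 = |X| and λ = μ − l, this is A² = tI + λA + μ(J − I − A).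

open import Defs
open import Data.Bool using (Bool; true; false; _∧_; _∨_; not; if_then_else_)
open import Data.Bool.Properties using (∧-zeroʳ; ∧-identityʳ; ∨-identityʳ)
open import Data.Empty using (⊥-elim)
open import Data.Fin using (Fin; zero; suc; toℕ; fromℕ<; opposite; _↑ˡ_; _↑ʳ_)
open import Data.Fin.Properties using (toℕ-fromℕ<; fromℕ<-cong; toℕ-injective; toℕ<n; remQuot-combine)
import Data.Fin.Properties as Fin
open import Data.Integer using (ℤ; +_; _-_)
import Data.Integer as ℤ
import Data.Integer.Tactic.RingSolver as ℤ-Solver
import Data.Nat.Tactic.RingSolver as ℕ-Solver
open import Data.Nat using (ℕ; zero; suc; _+_; _*_; _∸_; _/_; _%_; _≤_; _<_; z<s; s<s; _≟_; NonZero)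
open import Data.Nat.Properties
open import Data.Nat.DivMod
open import Data.Nat.Divisibility using (_∣_; divides; m∣m*n; n∣m⇒m%n≡0; m%n≡0⇒n∣m)
open import Data.Product using (_×_; _,_; proj₂; ∃)
open import Function.Bundles using (_⇔_; Equivalence)
open import Relation.Nullary using (¬_; Dec; contradiction)
open import Relation.Nullary.Decidable using (⌊_⌋; yes; no)
open import Relation.Binary.PropositionalEquality

⟦_⟧ : Bool → ℕ
⟦ b ⟧ = if b then 1 else 0

⟦∧⟧ : ∀ a b → ⟦ a ∧ b ⟧ ≡ ⟦ a ⟧ * ⟦ b ⟧
⟦∧⟧ true  b = sym (+-identityʳ ⟦ b ⟧)
⟦∧⟧ false b = refl

true⇔true⇒≡ : ∀ {a b : Bool} → (a ≡ true → b ≡ true) → (b ≡ true → a ≡ true) → a ≡ b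
true⇔true⇒≡ {true}  {true}  _ _ = refl
true⇔true⇒≡ {true}  {false} f _ = sym (f refl)
true⇔true⇒≡ {false} {true}  _ g = g refl
true⇔true⇒≡ {false} {false} _ _ = refl

∧-true : ∀ {a b} → (a ∧ b) ≡ true → (a ≡ true) × (b ≡ true)
∧-true {true} {true} _ = refl , refl

∧-intro : ∀ {a b} → a ≡ true → b ≡ true → (a ∧ b) ≡ true
∧-intro refl refl = refl

anyFin-witness : ∀ {N} (p : Fin N → Bool) → anyFin p ≡ true → ∃ λ i → p i ≡ true
anyFin-witness {suc N} p any with p zero in eq
... | true  = zero , eq
... | false with anyFin-witness (λ i → p (suc i)) any
...   | i , pi = suc i , pi

anyFin-intro : ∀ {N} (p : Fin N → Bool) i → p i ≡ true → anyFin p ≡ true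
anyFin-intro p zero    pi rewrite pi = refl
anyFin-intro p (suc i) pi with p zero
... | true  = refl
... | false = anyFin-intro (λ i → p (suc i)) i pi

anyFin-none : ∀ {N} (p : Fin N → Bool) → (∀ i → p i ≡ false) → anyFin p ≡ false
anyFin-none {zero}  p none = refl
anyFin-none {suc N} p none rewrite none zero = anyFin-none (λ i → p (suc i)) (λ i → none (suc i))

⌊⌋-true⇒ : ∀ {p} {P : Set p} {Q : Dec P} → ⌊ Q ⌋ ≡ true → P
⌊⌋-true⇒ {Q = yes p} _ = p

⇒⌊⌋-true : ∀ {p} {P : Set p} {Q : Dec P} → P → ⌊ Q ⌋ ≡ true
⇒⌊⌋-true {Q = yes _}  _ = refl
⇒⌊⌋-true {Q = no ¬p} p = ⊥-elim (¬p p)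

exactlyOne : ∀ x y z → (x ≡ true → y ≡ false) → ((x ∨ y) ≡ true ⇔ not z ≡ true) →
  ⟦ x ⟧ + ⟦ y ⟧ + ⟦ z ⟧ ≡ 1
exactlyOne true  true  _     disjoint _ = contradiction (disjoint refl) λ ()
exactlyOne true  false false _ _        = refl
exactlyOne true  false true  _ covers   = contradiction (Equivalence.to covers refl) λ ()
exactlyOne false true  false _ _        = refl
exactlyOne false true  true  _ covers   = contradiction (Equivalence.to covers refl) λ ()
exactlyOne false false false _ covers   = contradiction (Equivalence.from covers refl) λ ()
exactlyOne false false true  _ _        = refl

dsrg-entry : ∀ c l μ (a : Bool) (δ : ℤ) → c + l * ⟦ a ⟧ ≡ μ →
  + c ≡ (+ μ ℤ.* δ) ℤ.+ ((+ μ - + l) ℤ.* b2z a) ℤ.+ (+ μ ℤ.* ((+ 1 - δ) - b2z a))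
dsrg-entry c l .(c + l * 0) false δ refl rewrite *-zeroʳ l | +-identityʳ c = identity (+ c) δ (+ l)
  where identity : ∀ x δ l → x ≡ x ℤ.* δ ℤ.+ (x - l) ℤ.* + 0 ℤ.+ x ℤ.* ((+ 1 - δ) - + 0)
        identity = ℤ-Solver.solve-∀
dsrg-entry c l .(c + l * 1) true  δ refl rewrite *-identityʳ l = identity (+ c) (+ l) δ
  where identity : ∀ x l δ → x ≡ (x ℤ.+ l) ℤ.* δ ℤ.+ ((x ℤ.+ l) - l) ℤ.* + 1 ℤ.+ (x ℤ.+ l) ℤ.* ((+ 1 - δ) - + 1)
        identity = ℤ-Solver.solve-∀

sumUpTo : ℕ → (ℕ → ℕ) → ℕ
sumUpTo zero    f = 0
sumUpTo (suc N) f = f 0 + sumUpTo N (λ k → f (suc k))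

sumUpTo-cong : ∀ N {f g : ℕ → ℕ} → (∀ k → k < N → f k ≡ g k) → sumUpTo N f ≡ sumUpTo N g
sumUpTo-cong zero    f≡g = refl
sumUpTo-cong (suc N) f≡g = cong₂ _+_ (f≡g 0 z<s) (sumUpTo-cong N (λ k k<N → f≡g (suc k) (s<s k<N)))

sumUpTo-+ : ∀ N f g → sumUpTo N (λ k → f k + g k) ≡ sumUpTo N f + sumUpTo N g
sumUpTo-+ zero    f g = refl
sumUpTo-+ (suc N) f g =
  trans (cong (λ s → f 0 + g 0 + s) (sumUpTo-+ N _ _)) (interchange (f 0) (g 0) _ _)
  where interchange : ∀ a b c d → a + b + (c + d) ≡ a + c + (b + d)
        interchange = ℕ-Solver.solve-∀

sumUpTo-*ˡ : ∀ N c f → sumUpTo N (λ k → c * f k) ≡ c * sumUpTo N f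
sumUpTo-*ˡ zero    c f = sym (*-zeroʳ c)
sumUpTo-*ˡ (suc N) c f =
  trans (cong (λ s → c * f 0 + s) (sumUpTo-*ˡ N c _)) (sym (*-distribˡ-+ c (f 0) _))

sumUpTo-const : ∀ N c → sumUpTo N (λ _ → c) ≡ N * c
sumUpTo-const zero    c = refl
sumUpTo-const (suc N) c = cong (λ s → c + s) (sumUpTo-const N c)

sumUpTo-++ : ∀ a b f → sumUpTo (a + b) f ≡ sumUpTo a f + sumUpTo b (λ k → f (a + k))
sumUpTo-++ zero    b f = refl
sumUpTo-++ (suc a) b f =
  trans (cong (λ s → f 0 + s) (sumUpTo-++ a b (λ k → f (suc k)))) (sym (+-assoc (f 0) _ _))

sumUpTo-suc : ∀ N f → sumUpTo (suc N) f ≡ sumUpTo N f + f N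
sumUpTo-suc zero    f = +-comm (f 0) 0
sumUpTo-suc (suc N) f =
  trans (cong (λ s → f 0 + s) (sumUpTo-suc N (λ k → f (suc k)))) (sym (+-assoc (f 0) _ _))

sumUpTo-rotate : ∀ N f → f N ≡ f 0 → sumUpTo N (λ k → f (suc k)) ≡ sumUpTo N f
sumUpTo-rotate N f fN≡f0 = +-cancelʳ-≡ (f 0) _ _ (begin
    sumUpTo N (λ k → f (suc k)) + f 0 ≡⟨ +-comm _ (f 0) ⟩
    sumUpTo (suc N) f                 ≡⟨ sumUpTo-suc N f ⟩
    sumUpTo N f + f N                 ≡⟨ cong (λ x → sumUpTo N f + x) fN≡f0 ⟩
    sumUpTo N f + f 0                 ∎)
  where open ≡-Reasoning

sumUpTo-translate : ∀ N f → (∀ k → f (k + N) ≡ f k) → ∀ a → sumUpTo N (λ k → f (a + k)) ≡ sumUpTo N f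
sumUpTo-translate N f periodic zero    = refl
sumUpTo-translate N f periodic (suc a) = begin
    sumUpTo N (λ k → f (suc a + k))  ≡⟨ sumUpTo-cong N (λ k _ → cong f (sym (+-suc a k))) ⟩
    sumUpTo N (λ k → f (a + suc k))  ≡⟨ sumUpTo-rotate N (λ k → f (a + k)) wraps ⟩
    sumUpTo N (λ k → f (a + k))      ≡⟨ sumUpTo-translate N f periodic a ⟩
    sumUpTo N f                      ∎
  where open ≡-Reasoning
        wraps : f (a + N) ≡ f (a + 0)
        wraps = trans (periodic a) (cong f (sym (+-identityʳ a)))

sumUpTo-reverse : ∀ N f → sumUpTo N (λ k → f (N ∸ suc k)) ≡ sumUpTo N f
sumUpTo-reverse zero    f = refl
sumUpTo-reverse (suc N) f = begin
    f N + sumUpTo N (λ k → f (N ∸ suc k)) ≡⟨ cong (λ s → f N + s) (sumUpTo-reverse N f) ⟩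
    f N + sumUpTo N f                     ≡⟨ +-comm (f N) _ ⟩
    sumUpTo N f + f N                     ≡⟨ sumUpTo-suc N f ⟨
    sumUpTo (suc N) f                     ∎
  where open ≡-Reasoning

sumUpTo-reflect : ∀ N f → (∀ k → f (k + N) ≡ f k) → sumUpTo N (λ k → f (N ∸ k)) ≡ sumUpTo N f
sumUpTo-reflect N f periodic = begin
    sumUpTo N (λ k → f (N ∸ k))             ≡⟨ sumUpTo-cong N (λ k k<N → cong f (+-∸-assoc 1 k<N)) ⟩
    sumUpTo N (λ k → f (suc (N ∸ suc k)))   ≡⟨ sumUpTo-reverse N (λ k → f (suc k)) ⟩
    sumUpTo N (λ k → f (suc k))             ≡⟨ sumUpTo-rotate N f (periodic 0) ⟩
    sumUpTo N f                             ∎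
  where open ≡-Reasoning

count-cong : ∀ {N} {p q : Fin N → Bool} → (∀ i → p i ≡ q i) → count p ≡ count q
count-cong {zero}  p≡q = refl
count-cong {suc N} p≡q = cong₂ (λ b c → ⟦ b ⟧ + c) (p≡q zero) (count-cong (λ i → p≡q (suc i)))

count-sumUpTo : ∀ N (f : ℕ → Bool) → count {N} (λ i → f (toℕ i)) ≡ sumUpTo N (λ k → ⟦ f k ⟧)
count-sumUpTo zero    f = refl
count-sumUpTo (suc N) f = cong (λ s → ⟦ f 0 ⟧ + s) (count-sumUpTo N (λ k → f (suc k)))

count-as-sum : ∀ {N} (p : Fin N → Bool) (f : ℕ → Bool) → (∀ k → p k ≡ f (toℕ k)) →
  count p ≡ sumUpTo N (λ k → ⟦ f k ⟧)
count-as-sum {N} p f p≡f = trans (count-cong p≡f) (count-sumUpTo N f)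

count-++ : ∀ a b (p : Fin (a + b) → Bool) →
  count p ≡ count (λ i → p (i ↑ˡ b)) + count (λ j → p (a ↑ʳ j))
count-++ zero    b p = refl
count-++ (suc a) b p =
  trans (cong (λ s → ⟦ p zero ⟧ + s) (count-++ a b (λ i → p (suc i)))) (sym (+-assoc ⟦ p zero ⟧ _ _))

sumUpTo-point : ∀ N {r} → r < N → sumUpTo N (λ k → ⟦ ⌊ k ≟ r ⌋ ⟧) ≡ 1
sumUpTo-point (suc N) {zero}  _         = cong suc (trans (sumUpTo-const N 0) (*-zeroʳ N))
sumUpTo-point (suc N) {suc r} (s<s r<N) =
  trans (sumUpTo-cong N (λ k _ → cong ⟦_⟧ (≟-suc k r))) (sumUpTo-point N r<N)
  where
    ≟-suc : ∀ k r → ⌊ suc k ≟ suc r ⌋ ≡ ⌊ k ≟ r ⌋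
    ≟-suc k r with k ≟ r | suc k ≟ suc r
    ... | yes _   | yes _   = refl
    ... | no  _   | no  _   = refl
    ... | yes k≡r | no  k≢r = ⊥-elim (k≢r (cong suc k≡r))
    ... | no  k≢r | yes k≡r = ⊥-elim (k≢r (suc-injective k≡r))

module Congruence (v : ℕ) .{{_ : NonZero v}} where

  infix 4 _≈_ _≈?_

  _≈_ : ℕ → ℕ → Set
  a ≈ b = a % v ≡ b % v

  _≈?_ : ℕ → ℕ → Bool
  a ≈? b = ⌊ a % v ≟ b % v ⌋

  0%v≡0 : 0 % v ≡ 0
  0%v≡0 = m*n%n≡0 0 v

  ≈?-cong : ∀ {a a' b b'} → a ≈ a' → b ≈ b' → (a ≈? b) ≡ (a' ≈? b')
  ≈?-cong a≈a' b≈b' = cong₂ (λ x y → ⌊ x ≟ y ⌋) a≈a' b≈b'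

  ≈-+ : ∀ {a b c d} → a ≈ b → c ≈ d → a + c ≈ b + d
  ≈-+ {a} {b} {c} {d} a≈b c≈d = begin
    (a + c) % v             ≡⟨ %-distribˡ-+ a c v ⟩
    (a % v + c % v) % v     ≡⟨ cong₂ (λ x y → (x + y) % v) a≈b c≈d ⟩
    (b % v + d % v) % v     ≡⟨ %-distribˡ-+ b d v ⟨
    (b + d) % v             ∎
    where open ≡-Reasoning

  ≈-+ʳ : ∀ a {c d} → c ≈ d → a + c ≈ a + d
  ≈-+ʳ a = ≈-+ {a} {a} refl

  ≈-absorbʳ : ∀ a {z} → z ≈ 0 → a + z ≈ a
  ≈-absorbʳ a z≈0 = trans (≈-+ʳ a z≈0) (cong (_% v) (+-identityʳ a))

  ∣⇒≈0 : ∀ {m} → v ∣ m → m ≈ 0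
  ∣⇒≈0 {m} v∣m = trans (n∣m⇒m%n≡0 m v v∣m) (sym 0%v≡0)

  ≈0⇒∣ : ∀ {m} → m ≈ 0 → v ∣ m
  ≈0⇒∣ {m} m≈0 = m%n≡0⇒n∣m m v (trans m≈0 0%v≡0)

  %≈ : ∀ {n} .{{_ : NonZero n}} → v ∣ n → ∀ m → m % n ≈ m
  %≈ {n} v∣n m = m∣n⇒o%n%m≡o%m v n m v∣n

  negate : ℕ → ℕ
  negate m = v ∸ m % v

  negate-cong : ∀ {a b} → a ≈ b → negate a ≡ negate b
  negate-cong a≈b = cong (v ∸_) a≈b

  +-negateʳ : ∀ m → m + negate m ≈ 0
  +-negateʳ m = begin
    (m + negate m) % v           ≡⟨ ≈-+ {m} {m % v} (sym (m%n%n≡m%n m v)) refl ⟩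
    (m % v + negate m) % v       ≡⟨ cong (_% v) (m+[n∸m]≡n (m%n≤n m v)) ⟩
    v % v                        ≡⟨ n%n≡0 v ⟩
    0                            ≡⟨ 0%v≡0 ⟨
    0 % v                        ∎
    where open ≡-Reasoning

  ≈-cancelʳ : ∀ {a b} c → a + c ≈ b + c → a ≈ b
  ≈-cancelʳ {a} {b} c a+c≈b+c = begin
    a % v                         ≡⟨ ≈-absorbʳ a (+-negateʳ c) ⟨
    (a + (c + negate c)) % v      ≡⟨ cong (_% v) (+-assoc a c _) ⟨
    (a + c + negate c) % v        ≡⟨ ≈-+ {a + c} {b + c} a+c≈b+c refl ⟩
    (b + c + negate c) % v        ≡⟨ cong (_% v) (+-assoc b c _) ⟩
    (b + (c + negate c)) % v      ≡⟨ ≈-absorbʳ b (+-negateʳ c) ⟩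
    b % v                         ∎
    where open ≡-Reasoning

  +-negateˡ : ∀ m → negate m + m ≈ 0
  +-negateˡ m = trans (cong (_% v) (+-comm (negate m) m)) (+-negateʳ m)

  +≈0⇒≈negate : ∀ {a b} → a + b ≈ 0 → b ≈ negate a
  +≈0⇒≈negate {a} {b} a+b≈0 = ≈-cancelʳ a (begin
    (b + a) % v          ≡⟨ cong (_% v) (+-comm b a) ⟩
    (a + b) % v          ≡⟨ a+b≈0 ⟩
    0 % v                ≡⟨ +-negateˡ a ⟨
    (negate a + a) % v   ∎)
    where open ≡-Reasoning

  negate-involutive : ∀ m → negate (negate m) ≈ m
  negate-involutive m = sym (+≈0⇒≈negate (+-negateˡ m))

  [d-m]+[m-d]≈0 : ∀ m d → d + negate m + (m + negate d) ≈ 0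
  [d-m]+[m-d]≈0 m d = begin
    (d + negate m + (m + negate d)) % v   ≡⟨ cong (_% v) (shuffle d (negate m) m (negate d)) ⟩
    (m + negate m + (d + negate d)) % v   ≡⟨ ≈-+ (+-negateʳ m) (+-negateʳ d) ⟩
    0 % v                                 ∎
    where open ≡-Reasoning
          shuffle : ∀ a b c d → a + b + (c + d) ≡ c + b + (a + d)
          shuffle = ℕ-Solver.solve-∀

  d-m≈?0≡m≈?d : ∀ m d → (d + negate m ≈? 0) ≡ (m ≈? d)
  d-m≈?0≡m≈?d m d =
    true⇔true⇒≡ (λ d-m≈?0 → ⇒⌊⌋-true (⇒ (⌊⌋-true⇒ d-m≈?0))) (λ m≈?d → ⇒⌊⌋-true (⇐ (⌊⌋-true⇒ m≈?d)))
    where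
      ⇒ : d + negate m ≈ 0 → m ≈ d
      ⇒ d-m≈0 = begin
        m % v                        ≡⟨ ≈-absorbʳ m d-m≈0 ⟨
        (m + (d + negate m)) % v     ≡⟨ cong (_% v) (x+[y+z]≡y+[x+z] m d (negate m)) ⟩
        (d + (m + negate m)) % v     ≡⟨ ≈-absorbʳ d (+-negateʳ m) ⟩
        d % v                        ∎
        where open ≡-Reasoning
              x+[y+z]≡y+[x+z] : ∀ x y z → x + (y + z) ≡ y + (x + z)
              x+[y+z]≡y+[x+z] = ℕ-Solver.solve-∀
      ⇐ : m ≈ d → d + negate m ≈ 0
      ⇐ m≈d = trans (cong (λ x → (d + x) % v) (negate-cong m≈d)) (+-negateʳ d)

  sum-residueClass : ∀ l d → sumUpTo (v * l) (λ k → ⟦ k ≈? d ⟧) ≡ l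
  sum-residueClass zero    d = cong (λ N → sumUpTo N (λ k → ⟦ k ≈? d ⟧)) (*-zeroʳ v)
  sum-residueClass (suc l) d = begin
    sumUpTo (v * suc l) (λ k → ⟦ k ≈? d ⟧)
      ≡⟨ cong (λ N → sumUpTo N (λ k → ⟦ k ≈? d ⟧)) (*-suc v l) ⟩
    sumUpTo (v + v * l) (λ k → ⟦ k ≈? d ⟧)
      ≡⟨ sumUpTo-++ v (v * l) _ ⟩
    sumUpTo v (λ k → ⟦ k ≈? d ⟧) + sumUpTo (v * l) (λ k → ⟦ v + k ≈? d ⟧)
      ≡⟨ cong₂ _+_ oneInFirstPeriod (sumUpTo-cong (v * l) (λ k _ → cong ⟦_⟧ (≈?-cong (v+k≈k k) refl))) ⟩
    1 + sumUpTo (v * l) (λ k → ⟦ k ≈? d ⟧)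
      ≡⟨ cong suc (sum-residueClass l d) ⟩
    suc l ∎
    where
      open ≡-Reasoning
      v+k≈k : ∀ k → v + k ≈ k
      v+k≈k k = trans (cong (_% v) (+-comm v k)) (≈-absorbʳ k (trans (n%n≡0 v) (sym 0%v≡0)))
      oneInFirstPeriod : sumUpTo v (λ k → ⟦ k ≈? d ⟧) ≡ 1
      oneInFirstPeriod = trans (sumUpTo-cong v (λ k k<v → cong (λ x → ⟦ ⌊ x ≟ d % v ⌋ ⟧) (m<n⇒m%n≡m k<v)))
                               (sumUpTo-point v (m%n<n d v))

module PeriodSums (v l : ℕ) .{{_ : NonZero v}} where

  open Congruence v

  Congruent : (ℕ → ℕ) → Set
  Congruent f = ∀ {a b} → a ≈ b → f a ≡ f b

  period≈0 : v * l ≈ 0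
  period≈0 = ∣⇒≈0 (m∣m*n l)

  periodic : ∀ {f} → Congruent f → ∀ k → f (k + v * l) ≡ f k
  periodic f-cong k = f-cong (≈-absorbʳ k period≈0)

  sum-translate : ∀ {f} → Congruent f → ∀ a (e : ℕ → ℕ) → (∀ k → e k ≈ a + k) →
    sumUpTo (v * l) (λ k → f (e k)) ≡ sumUpTo (v * l) f
  sum-translate {f} f-cong a e e≈a+k =
    trans (sumUpTo-cong (v * l) (λ k _ → f-cong (e≈a+k k))) (sumUpTo-translate (v * l) f (periodic f-cong) a)

  sum-reflect : ∀ {f} → Congruent f → ∀ a (e : ℕ → ℕ) → (∀ k → e k + k ≈ a) →
    sumUpTo (v * l) (λ k → f (e k)) ≡ sumUpTo (v * l) f
  sum-reflect {f} f-cong a e e+k≈a = begin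
    sumUpTo (v * l) (λ k → f (e k))               ≡⟨ sumUpTo-cong (v * l) (λ k k<N → f-cong (e≈a-k k k<N)) ⟩
    sumUpTo (v * l) (λ k → f (a + (v * l ∸ k)))   ≡⟨ sumUpTo-reflect (v * l) (λ j → f (a + j)) (λ j → f-cong (shift j)) ⟩
    sumUpTo (v * l) (λ k → f (a + k))             ≡⟨ sum-translate f-cong a (λ k → a + k) (λ _ → refl) ⟩
    sumUpTo (v * l) f                             ∎
    where
      open ≡-Reasoning
      shift : ∀ j → a + (j + v * l) ≈ a + j
      shift j = trans (cong (_% v) (sym (+-assoc a j _))) (≈-absorbʳ (a + j) period≈0)
      e≈a-k : ∀ k → k < v * l → e k ≈ a + (v * l ∸ k)
      e≈a-k k k<N = ≈-cancelʳ k (trans (e+k≈a k) (sym (begin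
        (a + (v * l ∸ k) + k) % v   ≡⟨ cong (_% v) (trans (+-assoc a _ k) (cong (λ x → a + x) (m∸n+n≡m (<⇒≤ k<N)))) ⟩
        (a + v * l) % v             ≡⟨ ≈-absorbʳ a period≈0 ⟩
        a % v                       ∎)))

  module Tournament (φ : ℕ → Bool) (φ-cong : ∀ {a b} → a ≈ b → φ a ≡ φ b)
    (trichotomy : ∀ m → ⟦ φ m ⟧ + ⟦ φ (negate m) ⟧ + ⟦ m ≈? 0 ⟧ ≡ 1) where

    size : ℕ
    size = sumUpTo (v * l) (λ m → ⟦ φ m ⟧)

    conv : ℕ → ℕ
    conv d = sumUpTo (v * l) (λ m → ⟦ φ m ∧ φ (d + negate m) ⟧)

    corr : ℕ → ℕ
    corr d = sumUpTo (v * l) (λ m → ⟦ φ m ∧ φ (m + d) ⟧)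

    ⟦φ⟧-cong : Congruent (λ m → ⟦ φ m ⟧)
    ⟦φ⟧-cong a≈b = cong ⟦_⟧ (φ-cong a≈b)

    size-identity : size + size + l ≡ v * l
    size-identity = begin
      size + size + l
        ≡⟨ cong₂ (λ x y → size + x + y) (sym (sum-reflect ⟦φ⟧-cong 0 negate (λ k → +-negateˡ k)))
                                        (sym (sum-residueClass l 0)) ⟩
      size + sumUpTo (v * l) (λ m → ⟦ φ (negate m) ⟧) + sumUpTo (v * l) (λ m → ⟦ m ≈? 0 ⟧)
        ≡⟨ cong (λ x → x + sumUpTo (v * l) (λ m → ⟦ m ≈? 0 ⟧)) (sumUpTo-+ (v * l) _ _) ⟨
      sumUpTo (v * l) (λ m → ⟦ φ m ⟧ + ⟦ φ (negate m) ⟧) + sumUpTo (v * l) (λ m → ⟦ m ≈? 0 ⟧)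
        ≡⟨ sumUpTo-+ (v * l) _ _ ⟨
      sumUpTo (v * l) (λ m → ⟦ φ m ⟧ + ⟦ φ (negate m) ⟧ + ⟦ m ≈? 0 ⟧)
        ≡⟨ sumUpTo-cong (v * l) (λ m _ → trichotomy m) ⟩
      sumUpTo (v * l) (λ _ → 1)
        ≡⟨ trans (sumUpTo-const (v * l) 1) (*-identityʳ (v * l)) ⟩
      v * l ∎
      where open ≡-Reasoning

    conv-substitute : ∀ a d (e : ℕ → ℕ) → (∀ k → k + a + e k ≈ d) →
      sumUpTo (v * l) (λ k → ⟦ φ (k + a) ∧ φ (e k) ⟧) ≡ conv d
    conv-substitute a d e sum≈d = begin
      sumUpTo (v * l) (λ k → ⟦ φ (k + a) ∧ φ (e k) ⟧)
        ≡⟨ sumUpTo-cong (v * l) (λ k _ → cong (λ b → ⟦ φ (k + a) ∧ b ⟧) (φ-cong (e≈d-m (k + a) (e k) (sum≈d k)))) ⟩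
      sumUpTo (v * l) (λ k → ⟦ φ (k + a) ∧ φ (d + negate (k + a)) ⟧)
        ≡⟨ sum-translate summand-cong a (λ k → k + a) (λ k → cong (_% v) (+-comm k a)) ⟩
      conv d ∎
      where
        open ≡-Reasoning
        summand-cong : Congruent (λ m → ⟦ φ m ∧ φ (d + negate m) ⟧)
        summand-cong m≈m' = cong₂ (λ x y → ⟦ x ∧ φ (d + y) ⟧) (φ-cong m≈m') (negate-cong m≈m')
        e≈d-m : ∀ m c → m + c ≈ d → c ≈ d + negate m
        e≈d-m m c m+c≈d = ≈-cancelʳ m (begin
          (c + m) % v                  ≡⟨ cong (_% v) (+-comm c m) ⟩
          (m + c) % v                  ≡⟨ m+c≈d ⟩
          d % v                        ≡⟨ ≈-absorbʳ d (+-negateʳ m) ⟨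
          (d + (m + negate m)) % v     ≡⟨ cong (λ x → (d + x) % v) (+-comm m _) ⟩
          (d + (negate m + m)) % v     ≡⟨ cong (_% v) (+-assoc d _ m) ⟨
          (d + negate m + m) % v       ∎)

    corr-substitute : ∀ a d (e : ℕ → ℕ) → (∀ k → e k ≈ k + a + d) →
      sumUpTo (v * l) (λ k → ⟦ φ (k + a) ∧ φ (e k) ⟧) ≡ corr d
    corr-substitute a d e e≈m+d = begin
      sumUpTo (v * l) (λ k → ⟦ φ (k + a) ∧ φ (e k) ⟧)
        ≡⟨ sumUpTo-cong (v * l) (λ k _ → cong (λ b → ⟦ φ (k + a) ∧ b ⟧) (φ-cong (e≈m+d k))) ⟩
      sumUpTo (v * l) (λ k → ⟦ φ (k + a) ∧ φ (k + a + d) ⟧)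
        ≡⟨ sum-translate summand-cong a (λ k → k + a) (λ k → cong (_% v) (+-comm k a)) ⟩
      corr d ∎
      where
        open ≡-Reasoning
        summand-cong : Congruent (λ m → ⟦ φ m ∧ φ (m + d) ⟧)
        summand-cong m≈m' = cong₂ (λ x y → ⟦ x ∧ y ⟧) (φ-cong m≈m') (φ-cong (≈-+ m≈m' refl))

    corr-via-difference : ∀ d → sumUpTo (v * l) (λ m → ⟦ φ (m + negate d) ∧ φ m ⟧) ≡ corr d
    corr-via-difference d = corr-substitute (negate d) d (λ m → m) (λ m → sym (begin
      (m + negate d + d) % v     ≡⟨ cong (_% v) (+-assoc m _ d) ⟩
      (m + (negate d + d)) % v   ≡⟨ ≈-absorbʳ m (+-negateˡ d) ⟩
      m % v                      ∎))
      where open ≡-Reasoning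

    sum-residueClass-∧ : ∀ d → sumUpTo (v * l) (λ m → ⟦ φ m ∧ (m ≈? d) ⟧) ≡ l * ⟦ φ d ⟧
    sum-residueClass-∧ d = begin
      sumUpTo (v * l) (λ m → ⟦ φ m ∧ (m ≈? d) ⟧)     ≡⟨ sumUpTo-cong (v * l) (λ m _ → cong ⟦_⟧ (φ-on-class m)) ⟩
      sumUpTo (v * l) (λ m → ⟦ φ d ∧ (m ≈? d) ⟧)     ≡⟨ sumUpTo-cong (v * l) (λ m _ → ⟦∧⟧ (φ d) (m ≈? d)) ⟩
      sumUpTo (v * l) (λ m → ⟦ φ d ⟧ * ⟦ m ≈? d ⟧)   ≡⟨ sumUpTo-*ˡ (v * l) ⟦ φ d ⟧ _ ⟩
      ⟦ φ d ⟧ * sumUpTo (v * l) (λ m → ⟦ m ≈? d ⟧)   ≡⟨ cong (λ x → ⟦ φ d ⟧ * x) (sum-residueClass l d) ⟩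
      ⟦ φ d ⟧ * l                                   ≡⟨ *-comm ⟦ φ d ⟧ l ⟩
      l * ⟦ φ d ⟧                                   ∎
      where
        open ≡-Reasoning
        φ-on-class : ∀ m → (φ m ∧ (m ≈? d)) ≡ (φ d ∧ (m ≈? d))
        φ-on-class m with m ≈? d in m≈?d
        ... | true  = cong (λ x → x ∧ true) (φ-cong (⌊⌋-true⇒ m≈?d))
        ... | false = trans (∧-zeroʳ (φ m)) (sym (∧-zeroʳ (φ d)))

    trichotomy-at-difference : ∀ d m →
      ⟦ φ m ∧ φ (d + negate m) ⟧ + ⟦ φ (m + negate d) ∧ φ m ⟧ + ⟦ φ m ∧ (m ≈? d) ⟧ ≡ ⟦ φ m ⟧
    trichotomy-at-difference d m with φ m
    ... | false = cong (λ x → ⟦ x ⟧ + 0) (∧-zeroʳ (φ (m + negate d)))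
    ... | true  = begin
      ⟦ φ (d + negate m) ⟧ + ⟦ φ (m + negate d) ∧ true ⟧ + ⟦ m ≈? d ⟧
        ≡⟨ cong₂ (λ x y → ⟦ φ (d + negate m) ⟧ + ⟦ x ⟧ + ⟦ y ⟧)
                 (trans (∧-identityʳ _) (φ-cong (+≈0⇒≈negate ([d-m]+[m-d]≈0 m d)))) (sym (d-m≈?0≡m≈?d m d)) ⟩
      ⟦ φ (d + negate m) ⟧ + ⟦ φ (negate (d + negate m)) ⟧ + ⟦ d + negate m ≈? 0 ⟧
        ≡⟨ trichotomy (d + negate m) ⟩
      1 ∎
      where open ≡-Reasoning

    conv+corr : ∀ d → conv d + corr d + l * ⟦ φ d ⟧ ≡ size
    conv+corr d = begin
      conv d + corr d + l * ⟦ φ d ⟧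
        ≡⟨ cong₂ (λ x y → conv d + x + y) (sym (corr-via-difference d)) (sym (sum-residueClass-∧ d)) ⟩
      conv d + sumUpTo (v * l) (λ m → ⟦ φ (m + negate d) ∧ φ m ⟧) + sumUpTo (v * l) (λ m → ⟦ φ m ∧ (m ≈? d) ⟧)
        ≡⟨ cong (λ x → x + sumUpTo (v * l) (λ m → ⟦ φ m ∧ (m ≈? d) ⟧)) (sumUpTo-+ (v * l) _ _) ⟨
      sumUpTo (v * l) (λ m → ⟦ φ m ∧ φ (d + negate m) ⟧ + ⟦ φ (m + negate d) ∧ φ m ⟧)
        + sumUpTo (v * l) (λ m → ⟦ φ m ∧ (m ≈? d) ⟧)
        ≡⟨ sumUpTo-+ (v * l) _ _ ⟨
      sumUpTo (v * l) (λ m → ⟦ φ m ∧ φ (d + negate m) ⟧ + ⟦ φ (m + negate d) ∧ φ m ⟧ + ⟦ φ m ∧ (m ≈? d) ⟧)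
        ≡⟨ sumUpTo-cong (v * l) (λ m _ → trichotomy-at-difference d m) ⟩
      size ∎
      where open ≡-Reasoning

module DihedralFacts (n : ℕ) .{{_ : NonZero n}} where

  open Dihedral n

  toℕ-modn : ∀ m → toℕ (modn m) ≡ m % n
  toℕ-modn m = toℕ-fromℕ< (m%n<n m n)

  modn-cong : ∀ {a b} → a % n ≡ b % n → modn a ≡ modn b
  modn-cong a≡b = fromℕ<-cong _ _ a≡b _ _

  modn-toℕ : ∀ c → modn (toℕ c) ≡ c
  modn-toℕ c = toℕ-injective (trans (toℕ-modn (toℕ c)) (m<n⇒m%n≡m (toℕ<n c)))

  ==-sound : ∀ {g h : D n} → (g == h) ≡ true → g ≡ h
  ==-sound {s , i} {t , j} g==h with ∧-true {s ==F t} g==h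
  ... | s==t , i==j = cong₂ _,_ (⌊⌋-true⇒ s==t) (⌊⌋-true⇒ i==j)

  ==-complete : ∀ {g h : D n} → g ≡ h → (g == h) ≡ true
  ==-complete {s , i} refl = ∧-intro (⇒⌊⌋-true {Q = s Fin.≟ s} refl) (⇒⌊⌋-true {Q = i Fin.≟ i} refl)

  pow-xpow : ∀ m j → pow (xpow m) j ≡ (zero , modn (m * j))
  pow-xpow m zero    = cong (zero ,_) (modn-cong (cong (_% n) (sym (*-zeroʳ m))))
  pow-xpow m (suc j) rewrite pow-xpow m j = cong (zero ,_) (modn-cong (begin
    (toℕ (modn m) + toℕ (modn (m * j))) % n  ≡⟨ cong₂ (λ a b → (a + b) % n) (toℕ-modn m) (toℕ-modn (m * j)) ⟩
    (m % n + (m * j) % n) % n                ≡⟨ %-distribˡ-+ m (m * j) n ⟨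
    (m + m * j) % n                          ≡⟨ cong (_% n) (*-suc m j) ⟨
    (m * suc j) % n                          ∎))
    where open ≡-Reasoning

  xpow-rotation : ∀ b i → xpow b · (zero , i) ≡ (zero , modn (b + toℕ i))
  xpow-rotation b i = cong (zero ,_) (modn-cong (≈ₙ-+ (trans (cong (_% n) (toℕ-modn b)) (m%n%n≡m%n b n)) refl))
    where open Congruence n using () renaming (≈-+ to ≈ₙ-+)

  rotation-·-a : ∀ c → (zero , c) · a ≡ (suc zero , c)
  rotation-·-a c = cong (suc zero ,_) (begin
    modn (toℕ c + toℕ (modn 0))   ≡⟨ cong (λ x → modn (toℕ c + x)) (trans (toℕ-modn 0) (m*n%n≡0 0 n)) ⟩
    modn (toℕ c + 0)              ≡⟨ cong modn (+-identityʳ (toℕ c)) ⟩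
    modn (toℕ c)                  ≡⟨ modn-toℕ c ⟩
    c                             ∎)
    where open ≡-Reasoning

  inCyc-sound : ∀ h g → inCyc h g ≡ true → ∃ λ j → g ≡ pow h j
  inCyc-sound h g g∈⟨h⟩ with anyFin-witness {n + n} _ g∈⟨h⟩
  ... | j , g==hʲ = toℕ j , ==-sound g==hʲ

  inCyc-complete : ∀ h j → j < n + n → inCyc h (pow h j) ≡ true
  inCyc-complete h j j<2n =
    anyFin-intro {n + n} _ (fromℕ< j<2n) (==-complete (cong (pow h) (sym (toℕ-fromℕ< j<2n))))

  inCn-rotation : ∀ c → inCn (zero , c) ≡ true
  inCn-rotation c = anyFin-intro {n} _ c (==-complete (sym (begin
    pow (xpow 1) (toℕ c)        ≡⟨ pow-xpow 1 (toℕ c) ⟩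
    (zero , modn (1 * toℕ c))   ≡⟨ cong (λ x → zero , modn x) (*-identityˡ (toℕ c)) ⟩
    (zero , modn (toℕ c))       ≡⟨ cong (zero ,_) (modn-toℕ c) ⟩
    (zero , c)                  ∎)))
    where open ≡-Reasoning

  inCn-reflection : ∀ c → inCn (suc zero , c) ≡ false
  inCn-reflection c = anyFin-none {n} _ (λ j → cong ((suc zero , c) ==_) (pow-xpow 1 (toℕ j)))

  count-vertices : ∀ (B : D n → Bool) →
    count {2 * n} (λ y → B (vtx y)) ≡ count (λ i → B (zero , i)) + count (λ i → B (suc zero , i))
  count-vertices B = begin
    count {2 * n} (λ y → B (vtx y))
      ≡⟨ count-++ n (n + 0) (λ y → B (vtx y)) ⟩
    count {n} (λ i → B (vtx (i ↑ˡ (n + 0)))) + count (λ j → B (vtx (n ↑ʳ j)))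
      ≡⟨ cong₂ _+_ (count-cong {n} (λ i → cong B (remQuot-combine zero i)))
                   (trans (count-++ n 0 (λ j → B (vtx (n ↑ʳ j)))) (+-identityʳ _)) ⟩
    count (λ i → B (zero , i)) + count (λ i → B (vtx (n ↑ʳ (i ↑ˡ 0))))
      ≡⟨ cong (λ x → count (λ i → B (zero , i)) + x) (count-cong (λ i → cong B (remQuot-combine (suc zero) i))) ⟩
    count (λ i → B (zero , i)) + count (λ i → B (suc zero , i)) ∎
    where open ≡-Reasoning

module SkewCayleyGraph (v l : ℕ) .{{_ : NonZero (v * l)}} (T : Fin (v * l) → Bool)
  (T<v : ∀ b → T b ≡ true → toℕ b < v)
  (X∩X⁻¹≡∅ : ∀ g → Dihedral.inX (v * l) v T g ≡ true → Dihedral.inX (v * l) v T (Dihedral.inv (v * l) g) ≡ false)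
  (X∪X⁻¹≡Cₙ∖⟨xᵛ⟩ : ∀ g → ((Dihedral.inX (v * l) v T g ∨ Dihedral.inX (v * l) v T (Dihedral.inv (v * l) g)) ≡ true)
                         ⇔ ((Dihedral.inCn (v * l) g ∧ not (Dihedral.inCyc (v * l) (Dihedral.xpow (v * l) v) g)) ≡ true))
  where

  private instance
    v-nonZero : NonZero v
    v-nonZero = m*n≢0⇒m≢0 v

  open Dihedral (v * l)
  open DihedralFacts (v * l)
  open Congruence v
  open PeriodSums v l

  inTmod : ℕ → Bool
  inTmod m = anyFin (λ b → T b ∧ ⌊ toℕ b ≟ m % v ⌋)

  inTmod-cong : ∀ {a b} → a ≈ b → inTmod a ≡ inTmod b
  inTmod-cong a≈b = cong (λ r → anyFin (λ b → T b ∧ ⌊ toℕ b ≟ r ⌋)) a≈b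

  toℕ-modn≈ : ∀ m → toℕ (modn m) ≈ m
  toℕ-modn≈ m = trans (cong (_% v) (toℕ-modn m)) (%≈ (m∣m*n l) m)

  ⟨xᵛ⟩-sound : ∀ {s c} → inCyc (xpow v) (s , c) ≡ true → s ≡ zero × toℕ c ≈ 0
  ⟨xᵛ⟩-sound {s} {c} c∈⟨xᵛ⟩ with inCyc-sound (xpow v) (s , c) c∈⟨xᵛ⟩
  ... | j , sc≡xᵛʲ with trans sc≡xᵛʲ (pow-xpow v j)
  ...   | refl = refl , trans (toℕ-modn≈ (v * j)) (∣⇒≈0 (m∣m*n j))

  ⟨xᵛ⟩-complete : ∀ {c} → toℕ c ≈ 0 → inCyc (xpow v) (zero , c) ≡ true
  ⟨xᵛ⟩-complete {c} c≈0 with ≈0⇒∣ c≈0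
  ... | divides q c≡qv = subst (λ g → inCyc (xpow v) g ≡ true) xᵛ^q≡c (inCyc-complete (xpow v) q q<2n)
    where
      q<2n : q < v * l + v * l
      q<2n = <-≤-trans (≤-<-trans (≤-trans (m≤m*n q v) (≤-reflexive (sym c≡qv))) (toℕ<n c)) (m≤m+n _ _)
      xᵛ^q≡c : pow (xpow v) q ≡ (zero , c)
      xᵛ^q≡c = trans (pow-xpow v q)
                     (cong (zero ,_) (trans (cong modn (trans (*-comm v q) (sym c≡qv))) (modn-toℕ c)))

  coset-witness : Fin (v * l) → Fin (v * l) → D (v * l) → Bool
  coset-witness c b h = inCyc (xpow v) h ∧ ((zero , c) == (xpow (toℕ b) · h))

  inX⇒inTmod : ∀ c → inX v T (zero , c) ≡ true → inTmod (toℕ c) ≡ true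
  inX⇒inTmod c c∈X with anyFin-witness (λ b → T b ∧ anyD (coset-witness c b)) c∈X
  ... | b , c∈xᵇ⟨xᵛ⟩ with ∧-true {T b} c∈xᵇ⟨xᵛ⟩
  ... | b∈T , ∃h with anyFin-witness (λ s → anyFin (λ i → coset-witness c b (s , i))) ∃h
  ... | s , ∃i with anyFin-witness (λ i → coset-witness c b (s , i)) ∃i
  ... | i , h-witness with ∧-true {inCyc (xpow v) (s , i)} h-witness
  ... | i∈⟨xᵛ⟩ , c==xᵇi with ⟨xᵛ⟩-sound {s} {i} i∈⟨xᵛ⟩
  ... | refl , i≈0 = anyFin-intro (λ b → T b ∧ ⌊ toℕ b ≟ toℕ c % v ⌋) b (∧-intro b∈T (⇒⌊⌋-true (sym c%v≡b)))
    where
      c≡xᵇi : c ≡ modn (toℕ b + toℕ i)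
      c≡xᵇi = cong proj₂ (trans (==-sound {zero , c} c==xᵇi) (xpow-rotation (toℕ b) i))
      c%v≡b : toℕ c % v ≡ toℕ b
      c%v≡b = begin
        toℕ c % v                       ≡⟨ cong (λ x → toℕ x % v) c≡xᵇi ⟩
        toℕ (modn (toℕ b + toℕ i)) % v  ≡⟨ toℕ-modn≈ _ ⟩
        (toℕ b + toℕ i) % v             ≡⟨ ≈-absorbʳ (toℕ b) i≈0 ⟩
        toℕ b % v                       ≡⟨ m<n⇒m%n≡m (T<v b b∈T) ⟩
        toℕ b                           ∎
        where open ≡-Reasoning

  inTmod⇒inX : ∀ c → inTmod (toℕ c) ≡ true → inX v T (zero , c) ≡ true
  inTmod⇒inX c c∈T⟨xᵛ⟩ with anyFin-witness (λ b → T b ∧ ⌊ toℕ b ≟ toℕ c % v ⌋) c∈T⟨xᵛ⟩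
  ... | b , b∈T∧b≡c%v with ∧-true {T b} b∈T∧b≡c%v
  ... | b∈T , b≡c%v =
    anyFin-intro (λ b → T b ∧ anyD (coset-witness c b)) b (∧-intro b∈T
      (anyFin-intro (λ s → anyFin (λ i → coset-witness c b (s , i))) zero
        (anyFin-intro (λ i → coset-witness c b (zero , i)) i (∧-intro i∈⟨xᵛ⟩ (==-complete c≡xᵇi)))))
    where
      b≡c%v′ : toℕ b ≡ toℕ c % v
      b≡c%v′ = ⌊⌋-true⇒ b≡c%v
      b≤c : toℕ b ≤ toℕ c
      b≤c = ≤-trans (≤-reflexive b≡c%v′) (m%n≤m (toℕ c) v)
      c-b<n : toℕ c ∸ toℕ b < v * l
      c-b<n = ≤-<-trans (m∸n≤m (toℕ c) (toℕ b)) (toℕ<n c)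
      i : Fin (v * l)
      i = fromℕ< c-b<n
      i∈⟨xᵛ⟩ : inCyc (xpow v) (zero , i) ≡ true
      i∈⟨xᵛ⟩ = ⟨xᵛ⟩-complete (≈-cancelʳ (toℕ b) (begin
        (toℕ i + toℕ b) % v               ≡⟨ cong (λ x → (x + toℕ b) % v) (toℕ-fromℕ< c-b<n) ⟩
        (toℕ c ∸ toℕ b + toℕ b) % v       ≡⟨ cong (_% v) (m∸n+n≡m b≤c) ⟩
        toℕ c % v                         ≡⟨ m%n%n≡m%n (toℕ c) v ⟨
        toℕ c % v % v                     ≡⟨ cong (_% v) b≡c%v′ ⟨
        toℕ b % v                         ∎))
        where open ≡-Reasoning
      c≡xᵇi : (zero , c) ≡ xpow (toℕ b) · (zero , i)
      c≡xᵇi = sym (begin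
        xpow (toℕ b) · (zero , i)           ≡⟨ xpow-rotation (toℕ b) i ⟩
        (zero , modn (toℕ b + toℕ i))       ≡⟨ cong (λ x → zero , modn (toℕ b + x)) (toℕ-fromℕ< c-b<n) ⟩
        (zero , modn (toℕ b + (toℕ c ∸ toℕ b))) ≡⟨ cong (λ x → zero , modn x) (m+[n∸m]≡n b≤c) ⟩
        (zero , modn (toℕ c))               ≡⟨ cong (zero ,_) (modn-toℕ c) ⟩
        (zero , c)                          ∎)
        where open ≡-Reasoning

  inX-rotation : ∀ c → inX v T (zero , c) ≡ inTmod (toℕ c)
  inX-rotation c = true⇔true⇒≡ (inX⇒inTmod c) (inTmod⇒inX c)

  inX-reflection : ∀ c → inX v T (suc zero , c) ≡ false
  inX-reflection c with inX v T (suc zero , c) in c∈X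
  ... | false = refl
  ... | true  with Equivalence.to (X∪X⁻¹≡Cₙ∖⟨xᵛ⟩ (suc zero , c))
                                 (subst (λ x → (x ∨ inX v T (inv (suc zero , c))) ≡ true) (sym c∈X) refl)
  ...   | c∈Cₙ rewrite inCn-reflection c = contradiction c∈Cₙ λ ()

  connection-set : ∀ s c → inXuXa v T (s , c) ≡ inTmod (toℕ c)
  connection-set zero c = begin
    inX v T (zero , c) ∨ anyD (reflected (zero , c))   ≡⟨ cong (λ x → inX v T (zero , c) ∨ x) (anyFin-none _ no-reflection) ⟩
    inX v T (zero , c) ∨ false                          ≡⟨ ∨-identityʳ _ ⟩
    inX v T (zero , c)                                  ≡⟨ inX-rotation c ⟩
    inTmod (toℕ c)                                      ∎
    where
      open ≡-Reasoning
      reflected : D (v * l) → D (v * l) → Bool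
      reflected g h = inX v T h ∧ (g == (h · a))
      no-reflection : ∀ s → anyFin (λ i → reflected (zero , c) (s , i)) ≡ false
      no-reflection zero       = anyFin-none _ (λ i → ∧-zeroʳ (inX v T (zero , i)))
      no-reflection (suc zero) = anyFin-none _ (λ i → cong (λ x → x ∧ _) (inX-reflection i))
  connection-set (suc zero) c rewrite inX-reflection c = trans (true⇔true⇒≡ ⇒ ⇐) (inX-rotation c)
    where
      reflected : D (v * l) → Bool
      reflected h = inX v T h ∧ ((suc zero , c) == (h · a))
      ⇒ : anyD reflected ≡ true → inX v T (zero , c) ≡ true
      ⇒ ∃h with anyFin-witness (λ s → anyFin (λ i → reflected (s , i))) ∃h
      ... | s , ∃i with anyFin-witness (λ i → reflected (s , i)) ∃i
      ... | i , h-witness with s | ∧-true {inX v T (s , i)} h-witness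
      ...   | zero       | i∈X , c==ia with trans (==-sound {suc zero , c} c==ia) (rotation-·-a i)
      ...     | refl = i∈X
      ⇒ _ | _ | i , _ | suc zero | i∈X , _ = contradiction (trans (sym i∈X) (inX-reflection i)) λ ()
      ⇐ : inX v T (zero , c) ≡ true → anyD reflected ≡ true
      ⇐ c∈X = anyFin-intro (λ s → anyFin (λ i → reflected (s , i))) zero
                (anyFin-intro (λ i → reflected (zero , i)) c (∧-intro c∈X (==-complete (sym (rotation-·-a c)))))

  neg≈negate : ∀ i → toℕ (neg i) ≈ negate (toℕ i)
  neg≈negate i = trans (toℕ-modn≈ _) (+≈0⇒≈negate (trans (cong (_% v) (m+[n∸m]≡n (<⇒≤ (toℕ<n i)))) period≈0))

  inCyc-xᵛ : ∀ c → inCyc (xpow v) (zero , c) ≡ (toℕ c ≈? 0)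
  inCyc-xᵛ c = true⇔true⇒≡ (λ c∈⟨xᵛ⟩ → ⇒⌊⌋-true (proj₂ (⟨xᵛ⟩-sound c∈⟨xᵛ⟩)))
                           (λ c≈0 → ⟨xᵛ⟩-complete (⌊⌋-true⇒ c≈0))

  inTmod-trichotomy : ∀ m → ⟦ inTmod m ⟧ + ⟦ inTmod (negate m) ⟧ + ⟦ m ≈? 0 ⟧ ≡ 1
  inTmod-trichotomy m = begin
    ⟦ inTmod m ⟧ + ⟦ inTmod (negate m) ⟧ + ⟦ m ≈? 0 ⟧
      ≡⟨ cong₂ (λ x y → ⟦ x ⟧ + ⟦ inTmod (negate m) ⟧ + ⟦ y ⟧) (inTmod-cong (sym c≈m)) (≈?-cong (sym c≈m) refl) ⟩
    ⟦ inTmod (toℕ c) ⟧ + ⟦ inTmod (negate m) ⟧ + ⟦ toℕ c ≈? 0 ⟧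
      ≡⟨ cong (λ x → ⟦ inTmod (toℕ c) ⟧ + ⟦ x ⟧ + ⟦ toℕ c ≈? 0 ⟧)
              (inTmod-cong (trans (sym (cong (_% v) (negate-cong c≈m))) (sym (neg≈negate c)))) ⟩
    ⟦ inTmod (toℕ c) ⟧ + ⟦ inTmod (toℕ (neg c)) ⟧ + ⟦ toℕ c ≈? 0 ⟧
      ≡⟨ cong₂ (λ x y → ⟦ x ⟧ + ⟦ y ⟧ + ⟦ toℕ c ≈? 0 ⟧) (inX-rotation c) (inX-rotation (neg c)) ⟨
    ⟦ inX v T g ⟧ + ⟦ inX v T (inv g) ⟧ + ⟦ toℕ c ≈? 0 ⟧
      ≡⟨ cong (λ x → ⟦ inX v T g ⟧ + ⟦ inX v T (inv g) ⟧ + ⟦ x ⟧) (inCyc-xᵛ c) ⟨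
    ⟦ inX v T g ⟧ + ⟦ inX v T (inv g) ⟧ + ⟦ inCyc (xpow v) g ⟧
      ≡⟨ exactlyOne _ _ _ (X∩X⁻¹≡∅ g) covers ⟩
    1 ∎
    where
      open ≡-Reasoning
      c = modn m
      g = (zero , c)
      c≈m : toℕ c ≈ m
      c≈m = toℕ-modn≈ m
      covers : (inX v T g ∨ inX v T (inv g)) ≡ true ⇔ not (inCyc (xpow v) g) ≡ true
      covers = subst (λ x → (inX v T g ∨ inX v T (inv g)) ≡ true ⇔ (x ∧ not (inCyc (xpow v) g)) ≡ true)
                     (inCn-rotation c) (X∪X⁻¹≡Cₙ∖⟨xᵛ⟩ g)

  open Tournament inTmod inTmod-cong inTmod-trichotomy

  A : D (v * l) → D (v * l) → Bool
  A = cayley (inXuXa v T)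

  -- (xʲ aᵗ)(xⁱ aˢ)⁻¹ = x^(j + offset s t i) a^(s + t), exponents read modulo v.
  offset : Fin 2 → Fin 2 → ℕ → ℕ
  offset zero       zero       k = negate k
  offset (suc zero) (suc zero) k = negate k
  offset zero       (suc zero) k = k
  offset (suc zero) zero       k = k

  offset-same : ∀ t k → offset t t k ≡ negate k
  offset-same zero       k = refl
  offset-same (suc zero) k = refl

  offset-opposite : ∀ t k → offset (opposite t) t k ≡ k
  offset-opposite zero       k = refl
  offset-opposite (suc zero) k = refl

  offset-cancel : ∀ s t k → offset s (opposite t) k + offset s t k ≈ 0
  offset-cancel zero       zero       k = +-negateʳ k
  offset-cancel zero       (suc zero) k = +-negateˡ k
  offset-cancel (suc zero) zero       k = +-negateˡ k
  offset-cancel (suc zero) (suc zero) k = +-negateʳ k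

  connection-set-modn : ∀ s m → inXuXa v T (s , modn m) ≡ inTmod m
  connection-set-modn s m = trans (connection-set s (modn m)) (inTmod-cong (toℕ-modn≈ m))

  adjacency : ∀ s i t j → A (s , i) (t , j) ≡ inTmod (toℕ j + offset s t (toℕ i))
  adjacency zero       i zero       j = trans (connection-set-modn zero _) (inTmod-cong (≈-+ʳ (toℕ j) (neg≈negate i)))
  adjacency zero       i (suc zero) j = trans (connection-set-modn (suc zero) _) (inTmod-cong (≈-+ʳ (toℕ j) neg-neg≈))
    where
      neg-neg≈ : toℕ (neg (neg i)) ≈ toℕ i
      neg-neg≈ = trans (neg≈negate (neg i)) (trans (cong (_% v) (negate-cong (neg≈negate i))) (negate-involutive (toℕ i)))
  adjacency (suc zero) i zero       j = connection-set-modn (suc zero) _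
  adjacency (suc zero) i (suc zero) j = trans (connection-set-modn zero _) (inTmod-cong (≈-+ʳ (toℕ j) (neg≈negate i)))

  adjacency-same : ∀ t k j → A (t , k) (t , j) ≡ inTmod (toℕ j + negate (toℕ k))
  adjacency-same t k j = trans (adjacency t k t j) (cong (λ x → inTmod (toℕ j + x)) (offset-same t (toℕ k)))

  adjacency-opposite : ∀ t k j → A (opposite t , k) (t , j) ≡ inTmod (toℕ j + toℕ k)
  adjacency-opposite t k j = trans (adjacency (opposite t) k t j) (cong (λ x → inTmod (toℕ j + x)) (offset-opposite t (toℕ k)))

  out-half : ∀ s i r → count (λ k → A (s , i) (r , k)) ≡ size
  out-half s i r = trans (count-as-sum _ (λ k → inTmod (k + o)) (adjacency s i r))
                         (sum-translate ⟦φ⟧-cong o (λ k → k + o) (λ k → cong (_% v) (+-comm k o)))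
    where o = offset s r (toℕ i)

  in-half-same : ∀ t j → count (λ k → A (t , k) (t , j)) ≡ size
  in-half-same t j = trans (count-as-sum _ (λ k → inTmod (toℕ j + negate k)) (λ k → adjacency-same t k j))
                           (sum-reflect ⟦φ⟧-cong (toℕ j) (λ k → toℕ j + negate k) j-k+k≈j)
    where j-k+k≈j : ∀ k → toℕ j + negate k + k ≈ toℕ j
          j-k+k≈j k = trans (cong (_% v) (+-assoc (toℕ j) _ k)) (≈-absorbʳ (toℕ j) (+-negateˡ k))

  in-half-opposite : ∀ t j → count (λ k → A (opposite t , k) (t , j)) ≡ size
  in-half-opposite t j = trans (count-as-sum _ (λ k → inTmod (toℕ j + k)) (λ k → adjacency-opposite t k j))
                               (sum-translate ⟦φ⟧-cong (toℕ j) (λ k → toℕ j + k) (λ k → refl))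

  out-degree : ∀ g → count (λ y → A g (vtx y)) ≡ size + size
  out-degree (s , i) = trans (count-vertices (A (s , i))) (cong₂ _+_ (out-half s i zero) (out-half s i (suc zero)))

  in-degree : ∀ h → count (λ y → A (vtx y) h) ≡ size + size
  in-degree (zero , j)     =
    trans (count-vertices (λ y → A y (zero , j))) (cong₂ _+_ (in-half-same zero j) (in-half-opposite zero j))
  in-degree (suc zero , j) =
    trans (count-vertices (λ y → A y (suc zero , j))) (cong₂ _+_ (in-half-opposite (suc zero) j) (in-half-same (suc zero) j))

  walks-through-same : ∀ s i t j →
    count (λ k → A (s , i) (t , k) ∧ A (t , k) (t , j)) ≡ conv (toℕ j + offset s t (toℕ i))
  walks-through-same s i t j =
    trans (count-as-sum _ (λ k → inTmod (k + o) ∧ inTmod (toℕ j + negate k))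
                        (λ k → cong₂ _∧_ (adjacency s i t k) (adjacency-same t k j)))
          (conv-substitute o (toℕ j + o) (λ k → toℕ j + negate k)
             (λ k → trans (cong (_% v) (shuffle k o (toℕ j) (negate k))) (≈-+ (+-negateʳ k) refl)))
    where
      o = offset s t (toℕ i)
      shuffle : ∀ k o j k′ → k + o + (j + k′) ≡ k + k′ + (j + o)
      shuffle = ℕ-Solver.solve-∀

  walks-through-opposite : ∀ s i t j →
    count (λ k → A (s , i) (opposite t , k) ∧ A (opposite t , k) (t , j)) ≡ corr (toℕ j + offset s t (toℕ i))
  walks-through-opposite s i t j =
    trans (count-as-sum _ (λ k → inTmod (k + o′) ∧ inTmod (toℕ j + k))
                        (λ k → cong₂ _∧_ (adjacency s i (opposite t) k) (adjacency-opposite t k j)))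
          (corr-substitute o′ (toℕ j + o) (λ k → toℕ j + k)
             (λ k → sym (trans (cong (_% v) (shuffle k o′ (toℕ j) o)) (≈-absorbʳ (toℕ j + k) (offset-cancel s t (toℕ i))))))
    where
      o = offset s t (toℕ i)
      o′ = offset s (opposite t) (toℕ i)
      shuffle : ∀ k o′ j o → k + o′ + (j + o) ≡ j + k + (o′ + o)
      shuffle = ℕ-Solver.solve-∀

  walks-through-both : ∀ s i t j →
    count (λ k → A (s , i) (zero , k) ∧ A (zero , k) (t , j))
      + count (λ k → A (s , i) (suc zero , k) ∧ A (suc zero , k) (t , j))
      ≡ conv (toℕ j + offset s t (toℕ i)) + corr (toℕ j + offset s t (toℕ i))
  walks-through-both s i zero       j = cong₂ _+_ (walks-through-same s i zero j) (walks-through-opposite s i zero j)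
  walks-through-both s i (suc zero) j =
    trans (+-comm (count (λ k → A (s , i) (zero , k) ∧ A (zero , k) (suc zero , j))) _)
          (cong₂ _+_ (walks-through-same s i (suc zero) j) (walks-through-opposite s i (suc zero) j))

  walks : ∀ g h → count (λ y → A g (vtx y) ∧ A (vtx y) h) + l * ⟦ A g h ⟧ ≡ size
  walks (s , i) (t , j) = begin
    count (λ y → A (s , i) (vtx y) ∧ A (vtx y) (t , j)) + l * ⟦ A (s , i) (t , j) ⟧
      ≡⟨ cong₂ _+_ (trans (count-vertices (λ y → A (s , i) y ∧ A y (t , j))) (walks-through-both s i t j))
                   (cong (λ x → l * ⟦ x ⟧) (adjacency s i t j)) ⟩
    conv d + corr d + l * ⟦ inTmod d ⟧
      ≡⟨ conv+corr d ⟩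
    size ∎
    where
      open ≡-Reasoning
      d = toℕ j + offset s t (toℕ i)

  degree : size + size ≡ v * l ∸ l
  degree = sym (trans (cong (_∸ l) (sym size-identity)) (m+n∸n≡m (size + size) l))

  half-degree : (v * l ∸ l) / 2 ≡ size
  half-degree = trans (cong (_/ 2) (trans (sym degree) (double size))) (m*n/n≡m size 2)
    where double : ∀ x → x + x ≡ x * 2
          double = ℕ-Solver.solve-∀

  isDSRG : IsDSRG (2 * (v * l)) (+ (v * l ∸ l)) (+ ((v * l ∸ l) / 2)) (+ ((v * l ∸ l) / 2) - + l) (+ ((v * l ∸ l) / 2))
             (cayleyMat (inXuXa v T))
  isDSRG = record
    { JA≡kJ = λ w → cong +_ (trans (in-degree (vtx w)) degree)
    ; AJ≡kJ = λ u → cong +_ (trans (out-degree (vtx u)) degree)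
    ; A²≡   = λ u w → dsrg-entry _ l _ (A (vtx u) (vtx w)) (b2z (u ==F w)) (trans (walks (vtx u) (vtx w)) (sym half-degree))
    }

mainTheorem11 : (n : ℕ) .{{_ : NonZero n}} → (v l : ℕ) → ¬ (2 ∣ v) → n ≡ v * l →
    (T : Fin n → Bool) →
    (∀ b → T b ≡ true → (1 ≤ toℕ b) × (toℕ b < v)) →
    let open Dihedral n in
    (∀ g → inX v T g ≡ true → inX v T (inv g) ≡ false) →
    (∀ g → ((inX v T g ∨ inX v T (inv g)) ≡ true) ⇔ ((inCn g ∧ not (inCyc (xpow v) g)) ≡ true)) →
    IsDSRG (2 * n) (+ (n ∸ l)) (+ ((n ∸ l) / 2)) (+ ((n ∸ l) / 2) - + l) (+ ((n ∸ l) / 2))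
      (cayleyMat (inXuXa v T))
mainTheorem11 .(v * l) v l _ refl T T-range X∩X⁻¹≡∅ X∪X⁻¹≡Cₙ∖⟨xᵛ⟩ =
  SkewCayleyGraph.isDSRG v l T (λ b b∈T → proj₂ (T-range b b∈T)) X∩X⁻¹≡∅ X∪X⁻¹≡Cₙ∖⟨xᵛ⟩
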